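{- Let $G$ be a graph, $k\in \mathbb{N}$, and $u,v\in V(G)$ with $u \neq v$ and $uv\notin E(G)$. Then there is a graph $G'$ with vertex set $V(G')=V(G) \cup F$ (for some set $F$ disjoint from $V(G)$) such that $G=G'-F$ and the following holds: the inclusion-minimal solutions to $(G',k)$ are precisely the inclusion-minimal solutions $A$ to $(G,k)$ with $uv \notin A$. Furthermore, every solution $A$ to $(G',k)$ satisfies $uv \notin A$.
   Context: The prison is the 5-vertex graph obtained from $K_5$ by deleting two edges that share an endpoint; a graph is prison-free if it has no induced subgraph isomorphic to the prison. For a graph $H$ and integer $k$, a solution to $(H,k)$ (for Prison-free Edge Completion) is a set $A$ of non-edges of $H$ with $|A|\le k$ such that the graph obtained from $H$ by adding the edges of $A$ is prison-free. -}

module Defs where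

open import Data.Nat using (ℕ; _≤_)
open import Data.Nat.Base using (_<ᵇ_)
open import Data.Fin using (Fin; zero; suc; toℕ; _↑ˡ_; splitAt)
open import Data.Bool using (Bool; true; false; _∧_; if_then_else_)
open import Data.List using (List; map; concatMap; allFin)
open import Data.Nat.ListAction using (sum)
open import Data.Nat using (_+_; _≟_)
open import Data.Bool using (_∨_)
open import Data.Product using (proj₁; proj₂)
open import Relation.Nullary using (yes; no)
open import Data.Product using (_×_; _,_; ∃-syntax; Σ-syntax)
open import Data.Sum using (inj₁; inj₂)
open import Relation.Binary.PropositionalEquality using (_≡_; _≢_)
open import Relation.Nullary using (¬_)
open import Function.Definitions using (Injective)

record Graph (n : ℕ) : Set where
  field
    adj     : Fin n → Fin n → Bool
    adj-sym : ∀ i j → adj i j ≡ adj j i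
    adj-irr : ∀ i → adj i i ≡ false
open Graph public

-- A set of unordered pairs of vertices, as a symmetric irreflexive Boolean relation.
PairSet : ℕ → Set
PairSet n = Fin n → Fin n → Bool

allPairs : (n : ℕ) → List (Fin n × Fin n)
allPairs n = concatMap (λ i → map (λ j → (i , j)) (allFin n)) (allFin n)

size : ∀ {n} → PairSet n → ℕ
size {n} A = sum (map (λ p → if (toℕ (proj₁ p) <ᵇ toℕ (proj₂ p)) ∧ A (proj₁ p) (proj₂ p) then 1 else 0) (allPairs n))

-- The prison: K5 minus the two edges {0,1} and {0,2} (sharing endpoint 0).
prisonAdj : Fin 5 → Fin 5 → Bool
prisonAdj zero zero = false
prisonAdj zero (suc zero) = false
prisonAdj zero (suc (suc zero)) = false
prisonAdj zero _ = true
prisonAdj (suc zero) zero = false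
prisonAdj (suc (suc zero)) zero = false
prisonAdj (suc i) zero = true
prisonAdj (suc i) (suc j) with toℕ i ≟ toℕ j
... | yes _ = false
... | no _ = true

HasInducedPrison : ∀ {n} → (Fin n → Fin n → Bool) → Set
HasInducedPrison {n} adjH =
  ∃[ f ] (Injective _≡_ _≡_ f × (∀ (i j : Fin 5) → adjH (f i) (f j) ≡ prisonAdj i j))

PrisonFree : ∀ {n} → (Fin n → Fin n → Bool) → Set
PrisonFree adjH = ¬ HasInducedPrison adjH

addEdges : ∀ {n} → Graph n → PairSet n → Fin n → Fin n → Bool
addEdges H A i j = adj H i j ∨ A i j

Solution : ∀ {n} → Graph n → ℕ → PairSet n → Set
Solution H k A =
  (∀ i j → A i j ≡ A j i) ×
  (∀ i → A i i ≡ false) ×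
  (∀ i j → A i j ≡ true → adj H i j ≡ false) ×
  size A ≤ k ×
  PrisonFree (addEdges H A)

_⊆ₚ_ : ∀ {n} → PairSet n → PairSet n → Set
B ⊆ₚ A = ∀ i j → B i j ≡ true → A i j ≡ true

MinSolution : ∀ {n} → Graph n → ℕ → PairSet n → Set
MinSolution H k A = Solution H k A × (∀ B → Solution H k B → B ⊆ₚ A → A ⊆ₚ B)

liftPairs : ∀ {n} m → PairSet n → PairSet (n + m)
liftPairs {n} m A x y with splitAt n x | splitAt n y
... | inj₁ a | inj₁ b = A a b
... | _      | _      = false

{-# OPTIONS --safe #-}
-- Add two adjacent new hubs a, b, joined to u, v and to k + 1 new leaves c₀, …, cₖ.
-- If a solution of G′ contained uv, each {cᵣ, u, v, a, b} would induce a prison unless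
-- cᵣu or cᵣv were added as well, which costs more than k pairs. Conversely, a solution A
-- of G avoiding uv creates no prison in G′: vertices 1–4 of a prison form a K₄, but the
-- neighbours of new vertices lie among a, b, u, v and the leaves, which induce a
-- tripartite graph with parts {a}, {b}, {u, v, c₀, …, cₖ}. So a prison can meet the new
-- vertices only in its vertex 0, whose adjacent neighbours 3 and 4 would then be the
-- non-adjacent u, v. Hence solutions of G′ restrict to solutions of G avoiding uv, these
-- lift back, and the inclusion-minimal ones correspond.
module Submission where

open import Defs
open import Data.Nat using (ℕ; zero; suc; _+_; _≤_; _<_; z≤n; _<ᵇ_)
open import Data.Nat.Properties
  using (+-mono-≤; +-monoʳ-≤; +-comm; +-assoc; +-identityʳ; m≤m+n; m≤n+m; ≤-refl; ≤-reflexive; ≤-trans;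
         n<1+n; n≮n; <⇒<ᵇ; +-0-commutativeMonoid; module ≤-Reasoning)
import Data.Nat.ListAction as List
open import Data.Nat.ListAction.Properties using (sum-++)
open import Data.Fin using (Fin; zero; suc; #_; toℕ; _↑ˡ_; _↑ʳ_; splitAt)
open import Data.Fin.Properties
  using (_≟_; all?; pigeonhole; <⇒≢; splitAt-↑ˡ; splitAt-↑ʳ; toℕ-↑ˡ; toℕ-↑ʳ; toℕ<n; ↑ˡ-injective)
open import Data.List using (List; []; _∷_; map; concatMap; tabulate; allFin)
open import Data.List.Properties using (map-concatMap; map-tabulate)
open import Data.Bool using (Bool; true; false; not; _∧_; _∨_; if_then_else_)
open import Data.Bool.Properties using (∧-zeroʳ; ∨-identityʳ; ∨-zeroʳ; T-≡)
import Data.Bool.Properties as Bool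
open import Data.Maybe using (Maybe; just; nothing)
open import Data.Product using (_×_; _,_; ∃-syntax; proj₁; proj₂)
open import Data.Sum using (_⊎_; inj₁; inj₂)
open import Data.Empty using (⊥; ⊥-elim)
open import Relation.Nullary using (¬_; ¬?; yes; no; does)
open import Relation.Nullary.Decidable using (toWitness; _→-dec_; dec-true; dec-false)
open import Relation.Binary.PropositionalEquality using (_≡_; _≢_; refl; sym; trans; cong; cong₂; module ≡-Reasoning)
open import Function.Bundles using (Equivalence)
open import Function.Definitions using (Injective)
open import Algebra.Properties.CommutativeMonoid.Sum +-0-commutativeMonoid
  using (sum; sum-cong-≗; sum-replicate-zero; ∑-distrib-+)

-- Finite sums and pair counts

∑-mono-≤ : ∀ {N} {f g : Fin N → ℕ} → (∀ i → f i ≤ g i) → sum f ≤ sum g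
∑-mono-≤ {zero} f≤g = z≤n
∑-mono-≤ {suc N} f≤g = +-mono-≤ (f≤g zero) (∑-mono-≤ (λ i → f≤g (suc i)))

∑-↑ : ∀ n {m} (f : Fin (n + m) → ℕ) → sum f ≡ sum (λ i → f (i ↑ˡ m)) + sum (λ j → f (n ↑ʳ j))
∑-↑ zero f = refl
∑-↑ (suc n) f = trans (cong (f zero +_) (∑-↑ n (λ i → f (suc i)))) (sym (+-assoc (f zero) _ _))

∑-zero : ∀ {N} {f : Fin N → ℕ} → (∀ i → f i ≡ 0) → sum f ≡ 0
∑-zero {N} f≡0 = trans (sum-cong-≗ f≡0) (sum-replicate-zero N)

∑-positive-≥-length : ∀ {N} {f : Fin N → ℕ} → (∀ i → 1 ≤ f i) → N ≤ sum f
∑-positive-≥-length {zero} 1≤f = z≤n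
∑-positive-≥-length {suc N} 1≤f = +-mono-≤ (1≤f zero) (∑-positive-≥-length (λ i → 1≤f (suc i)))

term≤∑ : ∀ {N} (f : Fin N → ℕ) i → f i ≤ sum f
term≤∑ f zero = m≤m+n _ _
term≤∑ f (suc i) = ≤-trans (term≤∑ (λ j → f (suc j)) i) (m≤n+m _ _)

two-terms≤∑ : ∀ {N} (f : Fin N → ℕ) {i j} → i ≢ j → f i + f j ≤ sum f
two-terms≤∑ f {zero} {zero} i≢j = ⊥-elim (i≢j refl)
two-terms≤∑ f {zero} {suc j} _ = +-monoʳ-≤ (f zero) (term≤∑ (λ k → f (suc k)) j)
two-terms≤∑ f {suc i} {zero} _ rewrite +-comm (f (suc i)) (f zero) = +-monoʳ-≤ (f zero) (term≤∑ (λ k → f (suc k)) i)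
two-terms≤∑ f {suc i} {suc j} i≢j = ≤-trans (two-terms≤∑ (λ k → f (suc k)) (λ e → i≢j (cong suc e))) (m≤n+m _ _)

listSum-tabulate : ∀ {N} (f : Fin N → ℕ) → List.sum (tabulate f) ≡ sum f
listSum-tabulate {zero} f = refl
listSum-tabulate {suc N} f = cong (f zero +_) (listSum-tabulate (λ i → f (suc i)))

listSum-map-tabulate : ∀ {A : Set} {N} (h : A → ℕ) (f : Fin N → A) →
                       List.sum (map h (tabulate f)) ≡ sum (λ i → h (f i))
listSum-map-tabulate h f = trans (cong List.sum (map-tabulate f h)) (listSum-tabulate (λ i → h (f i)))

listSum-concatMap : ∀ {A : Set} (k : A → List ℕ) xs →
                    List.sum (concatMap k xs) ≡ List.sum (map (λ x → List.sum (k x)) xs)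
listSum-concatMap k [] = refl
listSum-concatMap k (x ∷ xs) =
  trans (sum-++ (k x) (concatMap k xs)) (cong (List.sum (k x) +_) (listSum-concatMap k xs))

listSum-allPairs : ∀ N (g : Fin N × Fin N → ℕ) → List.sum (map g (allPairs N)) ≡ sum (λ i → sum (λ j → g (i , j)))
listSum-allPairs N g = begin
  List.sum (map g (allPairs N))
    ≡⟨ cong List.sum (map-concatMap g row (allFin N)) ⟩
  List.sum (concatMap (λ i → map g (row i)) (allFin N))
    ≡⟨ listSum-concatMap _ (allFin N) ⟩
  List.sum (map (λ i → List.sum (map g (row i))) (allFin N))
    ≡⟨ listSum-map-tabulate (λ i → List.sum (map g (row i))) (λ i → i) ⟩
  sum (λ i → List.sum (map g (row i)))
    ≡⟨ sum-cong-≗ (λ i → trans (cong (λ l → List.sum (map g l)) (map-tabulate (λ j → j) (i ,_)))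
                                (listSum-map-tabulate g (i ,_))) ⟩
  sum (λ i → sum (λ j → g (i , j))) ∎
  where
  open ≡-Reasoning
  row : Fin N → List (Fin N × Fin N)
  row i = map (i ,_) (allFin N)

pairCount : ∀ {N} → PairSet N → Fin N → Fin N → ℕ
pairCount A i j = if (toℕ i <ᵇ toℕ j) ∧ A i j then 1 else 0

size≡∑∑ : ∀ {N} (A : PairSet N) → size A ≡ sum (λ i → sum (λ j → pairCount A i j))
size≡∑∑ {N} A = listSum-allPairs N (λ (i , j) → pairCount A i j)

pairCount-mono : ∀ {N} {A B : PairSet N} → B ⊆ₚ A → ∀ i j → pairCount B i j ≤ pairCount A i j
pairCount-mono {B = B} B⊆A i j with toℕ i <ᵇ toℕ j | B i j in Bij
... | false | _    = z≤n
... | true  | false = z≤n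
... | true  | true rewrite B⊆A i j Bij = ≤-refl

size-mono : ∀ {N} {A B : PairSet N} → B ⊆ₚ A → size B ≤ size A
size-mono {A = A} {B} B⊆A rewrite size≡∑∑ A | size≡∑∑ B = ∑-mono-≤ (λ i → ∑-mono-≤ (pairCount-mono B⊆A i))

pairCount-absent : ∀ {N} (A : PairSet N) {i j} → A i j ≡ false → pairCount A i j ≡ 0
pairCount-absent A {i} {j} Aij rewrite Aij | ∧-zeroʳ (toℕ i <ᵇ toℕ j) = refl

pairCount-present : ∀ {N} (A : PairSet N) {i j} → toℕ i < toℕ j → A i j ≡ true → pairCount A i j ≡ 1
pairCount-present A {i} {j} i<j Aij rewrite Aij | Equivalence.to T-≡ (<⇒<ᵇ i<j) = refl

two-rows≤size : ∀ {N} (A : PairSet N) {p q} → p ≢ q → sum (λ y → pairCount A p y + pairCount A q y) ≤ size A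
two-rows≤size A {p} {q} p≢q = begin
  sum (λ y → pairCount A p y + pairCount A q y)   ≡⟨ ∑-distrib-+ (pairCount A p) (pairCount A q) ⟩
  row p + row q                                   ≤⟨ two-terms≤∑ row p≢q ⟩
  sum row                                         ≡⟨ size≡∑∑ A ⟨
  size A ∎
  where
  open ≤-Reasoning
  row : _ → ℕ
  row i = sum (pairCount A i)

⊆ₚ-antisym : ∀ {N} {A B : PairSet N} → A ⊆ₚ B → B ⊆ₚ A → ∀ x y → A x y ≡ B x y
⊆ₚ-antisym {A = A} {B} A⊆B B⊆A x y with A x y in Axy | B x y in Bxy
... | false | false = refl
... | true  | true  = refl
... | false | true  = trans (sym Axy) (B⊆A x y Bxy)
... | true  | false = trans (sym (A⊆B x y Axy)) Bxy

⊆ₚ-absent : ∀ {N} {A B : PairSet N} → B ⊆ₚ A → ∀ {i j} → A i j ≡ false → B i j ≡ false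
⊆ₚ-absent {B = B} B⊆A {i} {j} Aij with B i j in Bij
... | false = refl
... | true  = trans (sym (B⊆A i j Bij)) Aij

-- Lifting pair sets from Fin n to Fin (n + m)

data Side (n m : ℕ) : Fin (n + m) → Set where
  old : (i : Fin n) → Side n m (i ↑ˡ m)
  new : (j : Fin m) → Side n m (n ↑ʳ j)

side : ∀ n m x → Side n m x
side zero    m x       = new x
side (suc n) m zero    = old zero
side (suc n) m (suc x) with side n m x
... | old i = old (suc i)
... | new j = new j

↑ˡ<↑ʳ : ∀ {n m} (i : Fin n) (j : Fin m) → toℕ (i ↑ˡ m) < toℕ (n ↑ʳ j)
↑ˡ<↑ʳ {n} {m} i j rewrite toℕ-↑ˡ i m | toℕ-↑ʳ n j = ≤-trans (toℕ<n i) (m≤m+n n (toℕ j))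

module _ {n} (m : ℕ) (A : PairSet n) where

  liftPairs-old : ∀ i j → liftPairs m A (i ↑ˡ m) (j ↑ˡ m) ≡ A i j
  liftPairs-old i j rewrite splitAt-↑ˡ n i m | splitAt-↑ˡ n j m = refl

  liftPairs-newˡ : ∀ j y → liftPairs m A (n ↑ʳ j) y ≡ false
  liftPairs-newˡ j y rewrite splitAt-↑ʳ n m j = refl

  liftPairs-newʳ : ∀ x j → liftPairs m A x (n ↑ʳ j) ≡ false
  liftPairs-newʳ x j with side n m x
  ... | old i rewrite splitAt-↑ˡ n i m | splitAt-↑ʳ n m j = refl
  ... | new i = liftPairs-newˡ i (n ↑ʳ j)

  liftPairs-elim : (P : Fin (n + m) → Fin (n + m) → Set) → (∀ i j → A i j ≡ true → P (i ↑ˡ m) (j ↑ˡ m)) →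
                   ∀ x y → liftPairs m A x y ≡ true → P x y
  liftPairs-elim P P-old x y Lxy with side n m x | side n m y
  ... | old i | old j = P-old i j (trans (sym (liftPairs-old i j)) Lxy)
  ... | old i | new j with () ← trans (sym (liftPairs-newʳ (i ↑ˡ m) j)) Lxy
  ... | new i | _     with () ← trans (sym (liftPairs-newˡ i y)) Lxy

  liftPairs-sym : (∀ i j → A i j ≡ A j i) → ∀ x y → liftPairs m A x y ≡ liftPairs m A y x
  liftPairs-sym A-sym x y with side n m x | side n m y
  ... | old i | old j = trans (liftPairs-old i j) (trans (A-sym i j) (sym (liftPairs-old j i)))
  ... | old i | new j = trans (liftPairs-newʳ (i ↑ˡ m) j) (sym (liftPairs-newˡ j (i ↑ˡ m)))
  ... | new i | _     = trans (liftPairs-newˡ i y) (sym (liftPairs-newʳ y i))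

  liftPairs-irr : (∀ i → A i i ≡ false) → ∀ x → liftPairs m A x x ≡ false
  liftPairs-irr A-irr x with side n m x
  ... | old i = trans (liftPairs-old i i) (A-irr i)
  ... | new j = liftPairs-newˡ j (n ↑ʳ j)

  pairCount-old : ∀ i j → pairCount (liftPairs m A) (i ↑ˡ m) (j ↑ˡ m) ≡ pairCount A i j
  pairCount-old i j rewrite toℕ-↑ˡ i m | toℕ-↑ˡ j m | liftPairs-old i j = refl

  size-liftPairs : size (liftPairs m A) ≡ size A
  size-liftPairs = begin
    size L                                                ≡⟨ size≡∑∑ L ⟩
    sum (λ x → sum (λ y → pairCount L x y))               ≡⟨ ∑-↑ n _ ⟩
    sum (λ i → sum (λ y → pairCount L (i ↑ˡ m) y)) + sum (λ j → sum (λ y → pairCount L (n ↑ʳ j) y))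
      ≡⟨ cong₂ _+_ (sum-cong-≗ old-row) (∑-zero (λ j → ∑-zero (λ y → pairCount-absent L (liftPairs-newˡ j y)))) ⟩
    sum (λ i → sum (λ j → pairCount A i j)) + 0           ≡⟨ +-identityʳ _ ⟩
    sum (λ i → sum (λ j → pairCount A i j))               ≡⟨ size≡∑∑ A ⟨
    size A ∎
    where
    open ≡-Reasoning
    L = liftPairs m A
    old-row : ∀ i → sum (λ y → pairCount L (i ↑ˡ m) y) ≡ sum (λ j → pairCount A i j)
    old-row i = begin
      sum (λ y → pairCount L (i ↑ˡ m) y)   ≡⟨ ∑-↑ n _ ⟩
      sum (λ j → pairCount L (i ↑ˡ m) (j ↑ˡ m)) + sum (λ j → pairCount L (i ↑ˡ m) (n ↑ʳ j))
        ≡⟨ cong₂ _+_ (sum-cong-≗ (pairCount-old i)) (∑-zero (λ j → pairCount-absent L (liftPairs-newʳ (i ↑ˡ m) j))) ⟩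
      sum (λ j → pairCount A i j) + 0      ≡⟨ +-identityʳ _ ⟩
      sum (λ j → pairCount A i j) ∎

restrictPairs : ∀ {n} m → PairSet (n + m) → PairSet n
restrictPairs m A′ i j = A′ (i ↑ˡ m) (j ↑ˡ m)

module _ {n : ℕ} (m : ℕ) where

  liftPairs-mono : {A B : PairSet n} → B ⊆ₚ A → liftPairs m B ⊆ₚ liftPairs m A
  liftPairs-mono {A} {B} B⊆A = liftPairs-elim m B (λ x y → liftPairs m A x y ≡ true)
    (λ i j Bij → trans (liftPairs-old m A i j) (B⊆A i j Bij))

  liftPairs-restrictPairs : (A′ : PairSet (n + m)) → liftPairs m (restrictPairs m A′) ⊆ₚ A′
  liftPairs-restrictPairs A′ = liftPairs-elim m (restrictPairs m A′) (λ x y → A′ x y ≡ true) (λ i j A′ij → A′ij)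

  size-restrictPairs : (A′ : PairSet (n + m)) → size (restrictPairs m A′) ≤ size A′
  size-restrictPairs A′ = ≤-trans (≤-reflexive (sym (size-liftPairs m (restrictPairs m A′))))
                                  (size-mono (liftPairs-restrictPairs A′))

-- Induced prisons

prisonAdj-twinFree : ∀ p q → (∀ r → prisonAdj p r ≡ prisonAdj q r) → p ≡ q
prisonAdj-twinFree =
  toWitness {a? = all? λ p → all? λ q → all? (λ r → prisonAdj p r Bool.≟ prisonAdj q r) →-dec p ≟ q} _

prisonAdj-clique : ∀ i j → i ≢ j → prisonAdj (suc i) (suc j) ≡ true
prisonAdj-clique =
  toWitness {a? = all? λ i → all? λ j → ¬? (i ≟ j) →-dec prisonAdj (suc i) (suc j) Bool.≟ true} _

module _ {N} {H : Fin N → Fin N → Bool} (H-sym : ∀ x y → H x y ≡ H y x) (H-irr : ∀ x → H x x ≡ false) where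

  inducedPrison : ∀ {x₀ x₁ x₂ x₃ x₄} →
    H x₀ x₁ ≡ false → H x₀ x₂ ≡ false → H x₀ x₃ ≡ true → H x₀ x₄ ≡ true → H x₁ x₂ ≡ true →
    H x₁ x₃ ≡ true → H x₁ x₄ ≡ true → H x₂ x₃ ≡ true → H x₂ x₄ ≡ true → H x₃ x₄ ≡ true →
    HasInducedPrison H
  inducedPrison {x₀} {x₁} {x₂} {x₃} {x₄} h₀₁ h₀₂ h₀₃ h₀₄ h₁₂ h₁₃ h₁₄ h₂₃ h₂₄ h₃₄ = x , x-injective , x-adj
    where
    x : Fin 5 → Fin N
    x zero                         = x₀
    x (suc zero)                   = x₁
    x (suc (suc zero))             = x₂
    x (suc (suc (suc zero)))       = x₃
    x (suc (suc (suc (suc zero)))) = x₄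

    x-adj : ∀ p q → H (x p) (x q) ≡ prisonAdj p q
    x-adj zero                         zero                         = H-irr x₀
    x-adj zero                         (suc zero)                   = h₀₁
    x-adj zero                         (suc (suc zero))             = h₀₂
    x-adj zero                         (suc (suc (suc zero)))       = h₀₃
    x-adj zero                         (suc (suc (suc (suc zero)))) = h₀₄
    x-adj (suc zero)                   zero                         = trans (H-sym x₁ x₀) h₀₁
    x-adj (suc zero)                   (suc zero)                   = H-irr x₁
    x-adj (suc zero)                   (suc (suc zero))             = h₁₂
    x-adj (suc zero)                   (suc (suc (suc zero)))       = h₁₃
    x-adj (suc zero)                   (suc (suc (suc (suc zero)))) = h₁₄
    x-adj (suc (suc zero))             zero                         = trans (H-sym x₂ x₀) h₀₂
    x-adj (suc (suc zero))             (suc zero)                   = trans (H-sym x₂ x₁) h₁₂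
    x-adj (suc (suc zero))             (suc (suc zero))             = H-irr x₂
    x-adj (suc (suc zero))             (suc (suc (suc zero)))       = h₂₃
    x-adj (suc (suc zero))             (suc (suc (suc (suc zero)))) = h₂₄
    x-adj (suc (suc (suc zero)))       zero                         = trans (H-sym x₃ x₀) h₀₃
    x-adj (suc (suc (suc zero)))       (suc zero)                   = trans (H-sym x₃ x₁) h₁₃
    x-adj (suc (suc (suc zero)))       (suc (suc zero))             = trans (H-sym x₃ x₂) h₂₃
    x-adj (suc (suc (suc zero)))       (suc (suc (suc zero)))       = H-irr x₃
    x-adj (suc (suc (suc zero)))       (suc (suc (suc (suc zero)))) = h₃₄
    x-adj (suc (suc (suc (suc zero)))) zero                         = trans (H-sym x₄ x₀) h₀₄
    x-adj (suc (suc (suc (suc zero)))) (suc zero)                   = trans (H-sym x₄ x₁) h₁₄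
    x-adj (suc (suc (suc (suc zero)))) (suc (suc zero))             = trans (H-sym x₄ x₂) h₂₄
    x-adj (suc (suc (suc (suc zero)))) (suc (suc (suc zero)))       = trans (H-sym x₄ x₃) h₃₄
    x-adj (suc (suc (suc (suc zero)))) (suc (suc (suc (suc zero)))) = H-irr x₄

    x-injective : Injective _≡_ _≡_ x
    x-injective {p} {q} xp≡xq = prisonAdj-twinFree p q λ r →
      trans (sym (x-adj p r)) (trans (cong (λ y → H y (x r)) xp≡xq) (x-adj q r))

module _ {n N} {H : Fin n → Fin n → Bool} {H′ : Fin N → Fin N → Bool}
         (e : Fin n → Fin N) (e-adj : ∀ i j → H′ (e i) (e j) ≡ H i j) where

  inducedPrison-embed : Injective _≡_ _≡_ e → HasInducedPrison H → HasInducedPrison H′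
  inducedPrison-embed e-inj (f , f-inj , f-adj) =
    (λ p → e (f p)) , (λ eq → f-inj (e-inj eq)) , λ p q → trans (e-adj (f p) (f q)) (f-adj p q)

  inducedPrison-reflect : (f : Fin 5 → Fin N) → Injective _≡_ _≡_ f → (∀ p q → H′ (f p) (f q) ≡ prisonAdj p q) →
    (∀ p → ∃[ i ] f p ≡ e i) → HasInducedPrison H
  inducedPrison-reflect f f-inj f-adj f≡e = g , g-inj , g-adj
    where
    g : Fin 5 → Fin n
    g p = proj₁ (f≡e p)
    f≡e∘g : ∀ p → f p ≡ e (g p)
    f≡e∘g p = proj₂ (f≡e p)
    g-inj : Injective _≡_ _≡_ g
    g-inj {p} {q} eq = f-inj (trans (f≡e∘g p) (trans (cong e eq) (sym (f≡e∘g q))))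
    g-adj : ∀ p q → H (g p) (g q) ≡ prisonAdj p q
    g-adj p q = trans (sym (e-adj (g p) (g q))) (trans (sym (cong₂ H′ (f≡e∘g p) (f≡e∘g q))) (f-adj p q))

IsClique : ∀ {N k} → (Fin N → Fin N → Bool) → (Fin k → Fin N) → Set
IsClique H g = ∀ i j → i ≢ j → H (g i) (g j) ≡ true

proper-colouring⇒no-clique : ∀ {N k} {H : Fin N → Fin N → Bool} (κ : Fin N → Maybe (Fin k)) →
  (∀ {x y c} → H x y ≡ true → κ x ≡ just c → κ y ≡ just c → ⊥) →
  (g : Fin (suc k) → Fin N) → IsClique H g → (∀ i → ∃[ c ] κ (g i) ≡ just c) → ⊥
proper-colouring⇒no-clique {k = k} κ proper g clique coloured
  with i , j , i<j , same ← pigeonhole (n<1+n k) (λ i → proj₁ (coloured i))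
  = proper (clique i j (<⇒≢ i<j)) (proj₂ (coloured i)) (trans (proj₂ (coloured j)) (cong just (sym same)))

module _ {N} {H : Fin N → Fin N → Bool} (S T : Fin N → Set)
         (S⊆T : ∀ {x} → S x → T x)
         (S-neighbours : ∀ {x y} → S x → H x y ≡ true → T y)
         (T∖S-independent : ∀ {x y} → T x → ¬ S x → T y → ¬ S y → H x y ≡ false)
         (T-K₄-free : (g : Fin 4 → Fin N) → IsClique H g → (∀ i → T (g i)) → ⊥) where

  -- Vertices 1–4 of the prison form a K₄, which lies in T once it meets S; so only vertex 0
  -- could lie in S, and then its adjacent neighbours 3 and 4 would lie in T ∖ S.
  inducedPrison-avoids : (f : Fin 5 → Fin N) → (∀ p q → H (f p) (f q) ≡ prisonAdj p q) → ∀ p → ¬ S (f p)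
  inducedPrison-avoids f f-adj = avoid
    where
    K₄ : Fin 4 → Fin N
    K₄ i = f (suc i)

    K₄-clique : IsClique H K₄
    K₄-clique i j i≢j = trans (f-adj (suc i) (suc j)) (prisonAdj-clique i j i≢j)

    K₄-avoids : ∀ q → ¬ S (K₄ q)
    K₄-avoids q Sq = T-K₄-free K₄ K₄-clique inT
      where
      inT : ∀ i → T (K₄ i)
      inT i with i ≟ q
      ... | yes refl = S⊆T Sq
      ... | no i≢q   = S-neighbours Sq (K₄-clique q i (λ q≡i → i≢q (sym q≡i)))

    nonadjacent₃₄ : S (f zero) → H (f (# 3)) (f (# 4)) ≡ false
    nonadjacent₃₄ S₀ = T∖S-independent (S-neighbours S₀ (f-adj zero (# 3))) (K₄-avoids (# 2))
                                       (S-neighbours S₀ (f-adj zero (# 4))) (K₄-avoids (# 3))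

    avoid : ∀ p → ¬ S (f p)
    avoid (suc q) = K₄-avoids q
    avoid zero S₀ with () ← trans (sym (nonadjacent₃₄ S₀)) (f-adj (# 3) (# 4))

module _ {n m} (G : Graph n) (G′ : Graph (n + m))
         (G′-old : ∀ i j → adj G′ (i ↑ˡ m) (j ↑ˡ m) ≡ adj G i j) where

  restrictPairs-solution : ∀ {k A′} → Solution G′ k A′ → Solution G k (restrictPairs m A′)
  restrictPairs-solution {A′ = A′} (A′-sym , A′-irr , A′-nonEdges , A′-size , A′-free) =
    (λ i j → A′-sym (i ↑ˡ m) (j ↑ˡ m)) ,
    (λ i → A′-irr (i ↑ˡ m)) ,
    (λ i j A′ij → trans (sym (G′-old i j)) (A′-nonEdges _ _ A′ij)) ,
    ≤-trans (size-restrictPairs m A′) A′-size ,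
    λ prison → A′-free (inducedPrison-embed {H = addEdges G (restrictPairs m A′)} {H′ = addEdges G′ A′}
                          (_↑ˡ m) (λ i j → cong₂ _∨_ (G′-old i j) refl) (↑ˡ-injective m _ _) prison)

-- The gadget

partAdj : ∀ {k} → Maybe (Fin k) → Maybe (Fin k) → Bool
partAdj (just c) (just d) = not (does (c ≟ d))
partAdj _        _        = false

partAdj-sym : ∀ {k} (p q : Maybe (Fin k)) → partAdj p q ≡ partAdj q p
partAdj-sym (just c) (just d) with c ≟ d
... | yes c≡d = cong not (sym (dec-true (d ≟ c) (sym c≡d)))
... | no  c≢d = cong not (sym (dec-false (d ≟ c) (λ d≡c → c≢d (sym d≡c))))
partAdj-sym (just _) nothing  = refl
partAdj-sym nothing  (just _) = refl
partAdj-sym nothing  nothing  = refl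

partAdj-same : ∀ {k} (c : Fin k) → partAdj (just c) (just c) ≡ false
partAdj-same c = cong not (dec-true (c ≟ c) refl)

partAdj-parted : ∀ {k} (p q : Maybe (Fin k)) → partAdj p q ≡ true → ∃[ d ] q ≡ just d
partAdj-parted (just _) (just d) _ = d , refl

-- New vertices: hubs a = n ↑ʳ 0, b = n ↑ʳ 1 and leaves cᵣ = n ↑ʳ (2 + r). The parts are
-- a ↦ 0, b ↦ 1 and u, v, cᵣ ↦ 2 (other old vertices have none); a pair involving a new
-- vertex is an edge iff its ends lie in different parts.
module Gadget {n} (G : Graph n) (k : ℕ) (u v : Fin n) where

  m : ℕ
  m = 2 + suc k

  terminalPart : Fin n → Maybe (Fin 3)
  terminalPart i with i ≟ u | i ≟ v
  ... | no _ | no _ = nothing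
  ... | _    | _    = just (# 2)

  terminalPart-u : terminalPart u ≡ just (# 2)
  terminalPart-u with u ≟ u
  ... | yes _  = refl
  ... | no u≢u = ⊥-elim (u≢u refl)

  terminalPart-v : terminalPart v ≡ just (# 2)
  terminalPart-v with v ≟ u | v ≟ v
  ... | yes _ | _      = refl
  ... | no _  | yes _  = refl
  ... | no _  | no v≢v = ⊥-elim (v≢v refl)

  terminalPart-just : ∀ {i c} → terminalPart i ≡ just c → i ≡ u ⊎ i ≡ v
  terminalPart-just {i} t with i ≟ u | i ≟ v
  ... | yes i≡u | _       = inj₁ i≡u
  ... | no _    | yes i≡v = inj₂ i≡v

  newPart : Fin m → Fin 3
  newPart zero          = # 0
  newPart (suc zero)    = # 1
  newPart (suc (suc _)) = # 2

  part : Fin n ⊎ Fin m → Maybe (Fin 3)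
  part (inj₁ i) = terminalPart i
  part (inj₂ j) = just (newPart j)

  gadgetAdj : Fin n ⊎ Fin m → Fin n ⊎ Fin m → Bool
  gadgetAdj (inj₁ i) (inj₁ j) = adj G i j
  gadgetAdj s        t        = partAdj (part s) (part t)

  gadgetAdj-sym : ∀ s t → gadgetAdj s t ≡ gadgetAdj t s
  gadgetAdj-sym (inj₁ i) (inj₁ j) = adj-sym G i j
  gadgetAdj-sym (inj₁ i) (inj₂ j) = partAdj-sym (terminalPart i) _
  gadgetAdj-sym (inj₂ i) (inj₁ j) = partAdj-sym _ (terminalPart j)
  gadgetAdj-sym (inj₂ i) (inj₂ j) = partAdj-sym (just (newPart i)) (just (newPart j))

  gadgetAdj-irr : ∀ s → gadgetAdj s s ≡ false
  gadgetAdj-irr (inj₁ i) = adj-irr G i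
  gadgetAdj-irr (inj₂ j) = partAdj-same (newPart j)

  G′ : Graph (n + m)
  G′ = record
    { adj     = λ x y → gadgetAdj (splitAt n x) (splitAt n y)
    ; adj-sym = λ x y → gadgetAdj-sym (splitAt n x) (splitAt n y)
    ; adj-irr = λ x → gadgetAdj-irr (splitAt n x)
    }

  partOf : Fin (n + m) → Maybe (Fin 3)
  partOf x = part (splitAt n x)

  partOf-old : ∀ i → partOf (i ↑ˡ m) ≡ terminalPart i
  partOf-old i rewrite splitAt-↑ˡ n i m = refl

  partOf-new : ∀ j → partOf (n ↑ʳ j) ≡ just (newPart j)
  partOf-new j rewrite splitAt-↑ʳ n m j = refl

  New : Fin (n + m) → Set
  New x = ∃[ j ] x ≡ n ↑ʳ j

  old-unless-new : ∀ x → ¬ New x → ∃[ i ] x ≡ i ↑ˡ m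
  old-unless-new x ¬new with side n m x
  ... | old i = i , refl
  ... | new j = ⊥-elim (¬new (j , refl))

  old-not-new : ∀ i → ¬ New (i ↑ˡ m)
  old-not-new i (j , eq)
    with () ← trans (sym (splitAt-↑ˡ n i m)) (trans (cong (splitAt n) eq) (splitAt-↑ʳ n m j))

  G′-old : ∀ i j → adj G′ (i ↑ˡ m) (j ↑ˡ m) ≡ adj G i j
  G′-old i j rewrite splitAt-↑ˡ n i m | splitAt-↑ˡ n j m = refl

  G′-new : ∀ {x y} → New x ⊎ New y → adj G′ x y ≡ partAdj (partOf x) (partOf y)
  G′-new (inj₁ (j , refl)) rewrite splitAt-↑ʳ n m j = refl
  G′-new {x} (inj₂ (j , refl)) with side n m x
  ... | old i rewrite splitAt-↑ˡ n i m | splitAt-↑ʳ n m j = refl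
  ... | new i rewrite splitAt-↑ʳ n m i | splitAt-↑ʳ n m j = refl

  u′ v′ hub₁ hub₂ : Fin (n + m)
  u′   = u ↑ˡ m
  v′   = v ↑ˡ m
  hub₁ = n ↑ʳ zero
  hub₂ = n ↑ʳ suc zero

  leaf : Fin (suc k) → Fin (n + m)
  leaf r = n ↑ʳ suc (suc r)

  module _ (A : PairSet n) (A-sym : ∀ i j → A i j ≡ A j i) (A-irr : ∀ i → A i i ≡ false)
           (G-uv : adj G u v ≡ false) (A-uv : A u v ≡ false) where

    private
      H : Fin (n + m) → Fin (n + m) → Bool
      H = addEdges G′ (liftPairs m A)

    H-old : ∀ i j → H (i ↑ˡ m) (j ↑ˡ m) ≡ addEdges G A i j
    H-old i j = cong₂ _∨_ (G′-old i j) (liftPairs-old m A i j)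

    H-new : ∀ {x y} → New x ⊎ New y → H x y ≡ partAdj (partOf x) (partOf y)
    H-new {x} {y} fresh = trans (cong₂ _∨_ (G′-new fresh) (lifted-absent fresh)) (∨-identityʳ _)
      where
      lifted-absent : New x ⊎ New y → liftPairs m A x y ≡ false
      lifted-absent (inj₁ (j , refl)) = liftPairs-newˡ m A j y
      lifted-absent (inj₂ (j , refl)) = liftPairs-newʳ m A x j

    terminals-nonadjacent : ∀ {i j c d} → terminalPart i ≡ just c → terminalPart j ≡ just d →
                            addEdges G A i j ≡ false
    terminals-nonadjacent ti tj with terminalPart-just ti | terminalPart-just tj
    ... | inj₁ refl | inj₁ refl = cong₂ _∨_ (adj-irr G u) (A-irr u)
    ... | inj₁ refl | inj₂ refl = cong₂ _∨_ G-uv A-uv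
    ... | inj₂ refl | inj₁ refl = cong₂ _∨_ (trans (adj-sym G v u) G-uv) (trans (A-sym v u) A-uv)
    ... | inj₂ refl | inj₂ refl = cong₂ _∨_ (adj-irr G v) (A-irr v)

    Parted : Fin (n + m) → Set
    Parted x = ∃[ c ] partOf x ≡ just c

    old-parted-nonadjacent : ∀ {x y} → Parted x → ¬ New x → Parted y → ¬ New y → H x y ≡ false
    old-parted-nonadjacent {x} {y} (c , xc) ¬new-x (d , yd) ¬new-y
      with old-unless-new x ¬new-x | old-unless-new y ¬new-y
    ... | i , refl | j , refl =
      trans (H-old i j) (terminals-nonadjacent (trans (sym (partOf-old i)) xc) (trans (sym (partOf-old j)) yd))

    same-part-nonadjacent : ∀ {x y c} → New x ⊎ New y → partOf x ≡ just c → partOf y ≡ just c →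
                            H x y ≡ false
    same-part-nonadjacent {c = c} fresh xc yc = trans (H-new fresh) (trans (cong₂ partAdj xc yc) (partAdj-same c))

    partOf-proper : ∀ {x y c} → H x y ≡ true → partOf x ≡ just c → partOf y ≡ just c → ⊥
    partOf-proper {x} {y} {c} Hxy xc yc with side n m x | side n m y
    ... | old i | old j with () ← trans (sym Hxy)
                                    (old-parted-nonadjacent (c , xc) (old-not-new i) (c , yc) (old-not-new j))
    ... | new i | _     with () ← trans (sym Hxy) (same-part-nonadjacent (inj₁ (i , refl)) xc yc)
    ... | old i | new j with () ← trans (sym Hxy) (same-part-nonadjacent (inj₂ (j , refl)) xc yc)

    liftPairs-prisonFree : PrisonFree (addEdges G A) → PrisonFree H
    liftPairs-prisonFree A-free (f , f-inj , f-adj) =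
      A-free (inducedPrison-reflect {H = addEdges G A} {H′ = H} (_↑ˡ m) H-old f f-inj f-adj
                                    (λ p → old-unless-new (f p) (avoids p)))
      where
      avoids : ∀ p → ¬ New (f p)
      avoids = inducedPrison-avoids {H = H} New Parted
        (λ { (j , refl) → newPart j , partOf-new j })
        (λ {x} fresh Hxy → partAdj-parted (partOf x) _ (trans (sym (H-new (inj₁ fresh))) Hxy))
        old-parted-nonadjacent
        (proper-colouring⇒no-clique partOf partOf-proper)
        f f-adj

  G′-new-old : ∀ j i → adj G′ (n ↑ʳ j) (i ↑ˡ m) ≡ partAdj (just (newPart j)) (terminalPart i)
  G′-new-old j i = trans (G′-new (inj₁ (j , refl))) (cong₂ partAdj (partOf-new j) (partOf-old i))

  G′-new-new : ∀ i j → adj G′ (n ↑ʳ i) (n ↑ʳ j) ≡ partAdj (just (newPart i)) (just (newPart j))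
  G′-new-new i j = trans (G′-new (inj₁ (i , refl))) (cong₂ partAdj (partOf-new i) (partOf-new j))

  G′-leaf-terminal : ∀ r {i} → terminalPart i ≡ just (# 2) → adj G′ (leaf r) (i ↑ˡ m) ≡ false
  G′-leaf-terminal r {i} t = trans (G′-new-old (suc (suc r)) i) (cong (partAdj (just (# 2))) t)

  G′-terminal-hub₁ : ∀ {i} → terminalPart i ≡ just (# 2) → adj G′ (i ↑ˡ m) hub₁ ≡ true
  G′-terminal-hub₁ {i} t = trans (adj-sym G′ _ _) (trans (G′-new-old zero i) (cong (partAdj (just (# 0))) t))

  G′-terminal-hub₂ : ∀ {i} → terminalPart i ≡ just (# 2) → adj G′ (i ↑ˡ m) hub₂ ≡ true
  G′-terminal-hub₂ {i} t = trans (adj-sym G′ _ _) (trans (G′-new-old (suc zero) i) (cong (partAdj (just (# 1))) t))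

  module _ {A′ : PairSet (n + m)} (A′-sym : ∀ x y → A′ x y ≡ A′ y x) (A′-irr : ∀ x → A′ x x ≡ false)
           (A′-free : PrisonFree (addEdges G′ A′)) (A′-uv : A′ u′ v′ ≡ true) where

    private
      H : Fin (n + m) → Fin (n + m) → Bool
      H = addEdges G′ A′

      H-sym : ∀ x y → H x y ≡ H y x
      H-sym x y = cong₂ _∨_ (adj-sym G′ x y) (A′-sym x y)

      H-irr : ∀ x → H x x ≡ false
      H-irr x = cong₂ _∨_ (adj-irr G′ x) (A′-irr x)

      edge : ∀ {x y} → adj G′ x y ≡ true → H x y ≡ true
      edge G′xy = cong (_∨ _) G′xy

    leaf-attached : ∀ r → A′ (leaf r) u′ ≡ true ⊎ A′ (leaf r) v′ ≡ true
    leaf-attached r with A′ (leaf r) u′ in ru | A′ (leaf r) v′ in rv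
    ... | true  | _     = inj₁ refl
    ... | false | true  = inj₂ refl
    ... | false | false = ⊥-elim (A′-free (inducedPrison H-sym H-irr
      (cong₂ _∨_ (G′-leaf-terminal r terminalPart-u) ru)
      (cong₂ _∨_ (G′-leaf-terminal r terminalPart-v) rv)
      (edge (G′-new-new (suc (suc r)) zero))
      (edge (G′-new-new (suc (suc r)) (suc zero)))
      (trans (cong (_ ∨_) A′-uv) (∨-zeroʳ _))
      (edge (G′-terminal-hub₁ terminalPart-u))
      (edge (G′-terminal-hub₂ terminalPart-u))
      (edge (G′-terminal-hub₁ terminalPart-v))
      (edge (G′-terminal-hub₂ terminalPart-v))
      (edge (G′-new-new zero (suc zero)))))

    leaves-exceed-budget : u ≢ v → suc k ≤ size A′
    leaves-exceed-budget u≢v = begin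
      suc k                                   ≤⟨ ∑-positive-≥-length leaf-counted ⟩
      sum (λ r → count (leaf r))              ≤⟨ ≤-trans (m≤n+m _ (count hub₂)) (m≤n+m _ (count hub₁)) ⟩
      sum (λ j → count (n ↑ʳ j))              ≤⟨ m≤n+m _ (sum (λ i → count (i ↑ˡ m))) ⟩
      sum (λ i → count (i ↑ˡ m)) + sum (λ j → count (n ↑ʳ j)) ≡⟨ ∑-↑ n count ⟨
      sum count                               ≤⟨ two-rows≤size A′ (λ u′≡v′ → u≢v (↑ˡ-injective m u v u′≡v′)) ⟩
      size A′ ∎
      where
      open ≤-Reasoning
      count : Fin (n + m) → ℕ
      count y = pairCount A′ u′ y + pairCount A′ v′ y
      leaf-counted : ∀ r → 1 ≤ count (leaf r)
      leaf-counted r with leaf-attached r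
      ... | inj₁ ru rewrite pairCount-present A′ (↑ˡ<↑ʳ u (suc (suc r))) (trans (A′-sym u′ (leaf r)) ru) = m≤m+n 1 _
      ... | inj₂ rv rewrite pairCount-present A′ (↑ˡ<↑ʳ v (suc (suc r))) (trans (A′-sym v′ (leaf r)) rv) = m≤n+m 1 _

  module _ (u≢v : u ≢ v) (G-uv : adj G u v ≡ false) where

    solution-avoids-uv : ∀ A′ → Solution G′ k A′ → A′ u′ v′ ≡ false
    solution-avoids-uv A′ (A′-sym , A′-irr , _ , A′-size , A′-free) with A′ u′ v′ in uv
    ... | false = refl
    ... | true  = ⊥-elim (n≮n k (≤-trans (leaves-exceed-budget A′-sym A′-irr A′-free uv u≢v) A′-size))

    liftPairs-solution : ∀ {A} → Solution G k A → A u v ≡ false → Solution G′ k (liftPairs m A)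
    liftPairs-solution {A} (A-sym , A-irr , A-nonEdges , A-size , A-free) A-uv =
      liftPairs-sym m A A-sym ,
      liftPairs-irr m A A-irr ,
      liftPairs-elim m A (λ x y → adj G′ x y ≡ false) (λ i j Aij → trans (G′-old i j) (A-nonEdges i j Aij)) ,
      ≤-trans (≤-reflexive (size-liftPairs m A)) A-size ,
      liftPairs-prisonFree A A-sym A-irr G-uv A-uv A-free

    restrictPairs-minimal : ∀ A′ → MinSolution G′ k A′ →
      ∃[ A ] (MinSolution G k A × A u v ≡ false × (∀ x y → A′ x y ≡ liftPairs m A x y))
    restrictPairs-minimal A′ (A′-sol , A′-min) = A , (A-sol , A-min) , A-uv , ⊆ₚ-antisym A′⊆LA LA⊆A′
      where
      A = restrictPairs m A′
      A-sol = restrictPairs-solution G G′ G′-old A′-sol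
      A-uv = solution-avoids-uv A′ A′-sol
      LA⊆A′ = liftPairs-restrictPairs m A′
      A′⊆LA = A′-min (liftPairs m A) (liftPairs-solution A-sol A-uv) LA⊆A′
      A-min : ∀ B → Solution G k B → B ⊆ₚ A → A ⊆ₚ B
      A-min B B-sol B⊆A i j Aij = trans (sym (liftPairs-old m B i j)) (A′⊆LB _ _ Aij)
        where
        LB⊆A′ : liftPairs m B ⊆ₚ A′
        LB⊆A′ x y LBxy = LA⊆A′ x y (liftPairs-mono m B⊆A x y LBxy)
        A′⊆LB = A′-min (liftPairs m B) (liftPairs-solution B-sol (⊆ₚ-absent B⊆A A-uv)) LB⊆A′

    liftPairs-minimal : ∀ A → MinSolution G k A → A u v ≡ false → MinSolution G′ k (liftPairs m A)
    liftPairs-minimal A (A-sol , A-min) A-uv = liftPairs-solution A-sol A-uv , LA-min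
      where
      LA-min : ∀ B′ → Solution G′ k B′ → B′ ⊆ₚ liftPairs m A → liftPairs m A ⊆ₚ B′
      LA-min B′ B′-sol B′⊆LA x y LAxy = liftPairs-restrictPairs m B′ x y (liftPairs-mono m A⊆RB′ x y LAxy)
        where
        RB′⊆A : restrictPairs m B′ ⊆ₚ A
        RB′⊆A i j RB′ij = trans (sym (liftPairs-old m A i j)) (B′⊆LA _ _ RB′ij)
        A⊆RB′ = A-min _ (restrictPairs-solution G G′ G′-old B′-sol) RB′⊆A

lemma10 : ∀ {n} (G : Graph n) (k : ℕ) (u v : Fin n) → u ≢ v → adj G u v ≡ false →
    ∃[ m ] ∃[ G' ]
      ((∀ (i j : Fin n) → adj {n + m} G' (i ↑ˡ m) (j ↑ˡ m) ≡ adj G i j) ×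
       (∀ A' → MinSolution G' k A' →
          ∃[ A ] (MinSolution G k A × A u v ≡ false × (∀ x y → A' x y ≡ liftPairs m A x y))) ×
       (∀ A → MinSolution G k A → A u v ≡ false → MinSolution G' k (liftPairs m A)) ×
       (∀ A' → Solution G' k A' → A' (u ↑ˡ m) (v ↑ˡ m) ≡ false))
lemma10 G k u v u≢v G-uv =
  m , G′ , G′-old ,
  restrictPairs-minimal u≢v G-uv , liftPairs-minimal u≢v G-uv , solution-avoids-uv u≢v G-uv
  where open Gadget G k u v
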